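{- For any tournament $T$ of order $n$, we have $\gamma_L(T)\leq\lceil n/2\rceil$ and the location number of $T$ is at most $\lfloor n/2\rfloor$.
   Context: A tournament has a unique arc between any pair of vertices. A set $S$ of vertices is locating if every vertex not in $S$ has a distinct set of in-neighbours in $S$; the location number is the minimum size of a locating set. A set is dominating if every vertex outside it has an in-neighbour in it, and locating-dominating if it is both locating and dominating; $\gamma_L(T)$ is the minimum size of a locating-dominating set. -}

module Defs where

open import Data.Nat using (ℕ; _≤_; ⌈_/2⌉; ⌊_/2⌋)
open import Data.Bool using (Bool; true; false; not)
open import Data.Fin using (Fin)
open import Data.Fin.Subset using (Subset; _∈_; _∉_; ∣_∣)
open import Data.Product using (Σ; ∃; _×_; _,_)
open import Relation.Binary.PropositionalEquality using (_≡_; _≢_)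
open import Relation.Nullary using (¬_)
open import Function.Bundles using (_⇔_)

record Tournament (n : ℕ) : Set where
  field
    arc     : Fin n → Fin n → Bool
    loopless : ∀ u → arc u u ≡ false
    unique-arc : ∀ u v → u ≢ v → arc u v ≡ not (arc v u)

open Tournament public

_⟶_within_ : {n : ℕ} → Fin n → Fin n → Tournament n → Set
u ⟶ v within T = arc T u v ≡ true

Locating : {n : ℕ} → Tournament n → Subset n → Set
Locating {n} T S =
  ∀ (u v : Fin n) → u ∉ S → v ∉ S → u ≢ v →
  ¬ (∀ w → w ∈ S → ((w ⟶ u within T) ⇔ (w ⟶ v within T)))

Dominating : {n : ℕ} → Tournament n → Subset n → Set
Dominating {n} T S =
  ∀ (v : Fin n) → v ∉ S → ∃ λ w → w ∈ S × (w ⟶ v within T)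

LocatingDominating : {n : ℕ} → Tournament n → Subset n → Set
LocatingDominating T S = Locating T S × Dominating T S

LocationNumber≤ : {n : ℕ} → Tournament n → ℕ → Set
LocationNumber≤ {n} T k = Σ (Subset n) λ S → Locating T S × ∣ S ∣ ≤ k

γL≤ : {n : ℕ} → Tournament n → ℕ → Set
γL≤ {n} T k = Σ (Subset n) λ S → LocatingDominating T S × ∣ S ∣ ≤ k

module Submission where

-- We prove a relative statement: for every set X of vertices there is a set S (not necessarily
-- inside X) of size at most ⌊(|X| + δ)/2⌋ locating the vertices of X ∖ S, and dominating them
-- when δ = 1.  Induction on |X|: choose keys k ∈ X and split X by the out-neighbourhoods of the
-- keys; the keys separate different parts, so solutions of the parts together with the keys
-- solve X.  A key costs a whole vertex but adds only half a vertex to the budget, while a part Y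
-- with |Y| + δ odd needs half a vertex less than its share (|Y| + δ)/2; so the split pays off as
-- soon as there are at least as many odd parts as keys.  A single key suffices unless |X| + δ is
-- odd and all out-degrees inside X are even; then two keys u → v suffice unless all joint
-- out-degrees are even too, and in that last case a directed triangle (which exists since
-- out-degrees are even) yields three keys and enough odd parts.

open import Defs
open import Algebra.Bundles using (CommutativeMonoid)
import Algebra.Properties.CommutativeSemigroup as CommutativeSemigroupProperties
open import Data.Bool.Base using (Bool; true; false; not)
import Data.Bool.Properties as 𝔹
open import Data.Fin.Base using (Fin; zero; suc)
open import Data.Fin.Properties using (_≟_; any?)
open import Data.Fin.Subset
open import Data.Fin.Subset.Properties
open import Data.Nat.Base
  using (ℕ; zero; suc; _+_; _≤_; _<_; z≤n; s≤s; s≤s⁻¹; ⌊_/2⌋; ⌈_/2⌉; parity)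
open import Data.Nat.Induction using (<-wellFounded)
open import Data.Nat.Properties
  using (module ≤-Reasoning; _≤?_; ≤-trans; ≤-reflexive; <-≤-trans; ≤-<-trans; ≰⇒>; n≤0⇒n≡0;
         +-suc; +-mono-≤; +-monoˡ-≤; +-monoʳ-≤; +-commutativeSemigroup; n≡⌊n+n/2⌋; ⌊n/2⌋-mono)
open import Data.Parity.Base using (Parity; 0ℙ; 1ℙ; _⁻¹) renaming (_+_ to _⊕_)
open import Data.Parity.Properties using (suc-homo-⁻¹; +-homo-+)
import Data.Parity.Properties as ℙ
open import Data.Product using (∃; _×_; _,_; proj₂)
open import Data.Sum using (_⊎_; inj₁; inj₂)
open import Data.Vec.Base using ([]; _∷_; here; there; tabulate)
open import Data.Vec.Properties using (lookup∘tabulate; lookup⇒[]=; []=⇒lookup)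
open import Function.Base using (_∘_; _on_)
open import Function.Bundles using (_⇔_; Equivalence)
open import Induction.WellFounded using (WfRec; module All)
open import Level using (0ℓ)
open import Relation.Binary.PropositionalEquality
import Relation.Binary.Construct.On as On
open import Relation.Nullary using (¬_; yes; no; contradiction)
open import Relation.Nullary.Decidable using (_×-dec_)

open CommutativeSemigroupProperties +-commutativeSemigroup using (interchange)

private
  variable
    n : ℕ
    p q S : Subset n
    x y : Fin n

∣p∣≡∣p∩q∣+∣p∩∁q∣ : ∀ (p q : Subset n) → ∣ p ∣ ≡ ∣ p ∩ q ∣ + ∣ p ∩ ∁ q ∣
∣p∣≡∣p∩q∣+∣p∩∁q∣ []            []            = refl
∣p∣≡∣p∩q∣+∣p∩∁q∣ (outside ∷ p) (_ ∷ q)       = ∣p∣≡∣p∩q∣+∣p∩∁q∣ p q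
∣p∣≡∣p∩q∣+∣p∩∁q∣ (inside ∷ p)  (inside ∷ q)  = cong suc (∣p∣≡∣p∩q∣+∣p∩∁q∣ p q)
∣p∣≡∣p∩q∣+∣p∩∁q∣ (inside ∷ p)  (outside ∷ q) =
  trans (cong suc (∣p∣≡∣p∩q∣+∣p∩∁q∣ p q)) (sym (+-suc _ _))

∣p∪q∣≤∣p∣+∣q∣ : ∀ (p q : Subset n) → ∣ p ∪ q ∣ ≤ ∣ p ∣ + ∣ q ∣
∣p∪q∣≤∣p∣+∣q∣ []            []            = z≤n
∣p∪q∣≤∣p∣+∣q∣ (outside ∷ p) (outside ∷ q) = ∣p∪q∣≤∣p∣+∣q∣ p q
∣p∪q∣≤∣p∣+∣q∣ (outside ∷ p) (inside ∷ q)  =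
  ≤-trans (s≤s (∣p∪q∣≤∣p∣+∣q∣ p q)) (≤-reflexive (sym (+-suc _ _)))
∣p∪q∣≤∣p∣+∣q∣ (inside ∷ p)  (s ∷ q)       =
  s≤s (≤-trans (∣p∪q∣≤∣p∣+∣q∣ p q) (+-monoʳ-≤ ∣ p ∣ (∣p∣≤∣x∷p∣ s q)))

x∈p⇒∣p∣≡1+∣p-x∣ : x ∈ p → ∣ p ∣ ≡ suc ∣ p - x ∣
x∈p⇒∣p∣≡1+∣p-x∣ {p = inside ∷ p}  here        = cong suc (cong ∣_∣ (sym (p─⊥≡p p)))
x∈p⇒∣p∣≡1+∣p-x∣ {p = outside ∷ p} (there x∈p) = x∈p⇒∣p∣≡1+∣p-x∣ x∈p
x∈p⇒∣p∣≡1+∣p-x∣ {p = inside ∷ p}  (there x∈p) = cong suc (x∈p⇒∣p∣≡1+∣p-x∣ x∈p)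

x∈p-y⇒x≢y : x ∈ p - y → x ≢ y
x∈p-y⇒x≢y {p = _ ∷ _} {y = zero}  ()            refl
x∈p-y⇒x≢y {p = _ ∷ _} {y = suc y} (there x∈p-y) refl = x∈p-y⇒x≢y x∈p-y refl

x∈p∧x∉S∧y∈S⇒x∈p-y : x ∈ p → x ∉ S → y ∈ S → x ∈ p - y
x∈p∧x∉S∧y∈S⇒x∈p-y x∈p x∉S y∈S = x∈p∧x≢y⇒x∈p-y x∈p (λ { refl → x∉S y∈S })

∩-swapʳ : ∀ (p q r : Subset n) → (p ∩ q) ∩ r ≡ (p ∩ r) ∩ q
∩-swapʳ {n} = xy∙z≈xz∙y
  where open CommutativeSemigroupProperties
               (CommutativeMonoid.commutativeSemigroup (∩-commutativeMonoid n))

x∈p⇒0<∣p∣ : x ∈ p → 0 < ∣ p ∣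
x∈p⇒0<∣p∣ x∈p = subst (0 <_) (sym (x∈p⇒∣p∣≡1+∣p-x∣ x∈p)) (s≤s z≤n)

0<∣p∣⇒Nonempty : 0 < ∣ p ∣ → Nonempty p
0<∣p∣⇒Nonempty {n} {p} 0<∣p∣ with nonempty? p
... | yes p≢∅ = p≢∅
... | no  p≡∅ with () ← subst (0 <_) (trans (cong ∣_∣ (Empty-unique p≡∅)) (∣⊥∣≡0 n)) 0<∣p∣

∈∧≢⇒2≤∣p∣ : x ∈ p → y ∈ p → x ≢ y → 2 ≤ ∣ p ∣
∈∧≢⇒2≤∣p∣ x∈p y∈p x≢y = subst (2 ≤_) (sym (x∈p⇒∣p∣≡1+∣p-x∣ x∈p))
  (s≤s (x∈p⇒0<∣p∣ (x∈p∧x≢y⇒x∈p-y y∈p (x≢y ∘ sym))))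

2≤∣p∣⇒∈∧≢ : 2 ≤ ∣ p ∣ → ∃ λ x → ∃ λ y → x ∈ p × y ∈ p × x ≢ y
2≤∣p∣⇒∈∧≢ {p = p} 2≤∣p∣ with 0<∣p∣⇒Nonempty (<-≤-trans (s≤s z≤n) 2≤∣p∣)
... | x , x∈p with 0<∣p∣⇒Nonempty (s≤s⁻¹ (subst (2 ≤_) (x∈p⇒∣p∣≡1+∣p-x∣ {p = p} x∈p) 2≤∣p∣))
... | y , y∈p-x = x , y , x∈p , p─q⊆p p ⁅ x ⁆ y∈p-x , x∈p-y⇒x≢y y∈p-x ∘ sym

⌊n/2⌋+⌊n/2⌋≤n : ∀ n → ⌊ n /2⌋ + ⌊ n /2⌋ ≤ n
⌊n/2⌋+⌊n/2⌋≤n zero          = z≤n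
⌊n/2⌋+⌊n/2⌋≤n (suc zero)    = z≤n
⌊n/2⌋+⌊n/2⌋≤n (suc (suc n)) =
  s≤s (≤-trans (≤-reflexive (+-suc ⌊ n /2⌋ ⌊ n /2⌋)) (s≤s (⌊n/2⌋+⌊n/2⌋≤n n)))

⌊n/2⌋+⌊n/2⌋<n : ∀ n → parity n ≡ 1ℙ → ⌊ n /2⌋ + ⌊ n /2⌋ < n
⌊n/2⌋+⌊n/2⌋<n (suc zero)    _   = s≤s z≤n
⌊n/2⌋+⌊n/2⌋<n (suc (suc n)) odd =
  s≤s (s≤s (≤-trans (≤-reflexive (+-suc ⌊ n /2⌋ ⌊ n /2⌋)) (⌊n/2⌋+⌊n/2⌋<n n odd)))

m+m≤n⇒m≤⌊n/2⌋ : ∀ {m n} → m + m ≤ n → m ≤ ⌊ n /2⌋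
m+m≤n⇒m≤⌊n/2⌋ {m} m+m≤n = ≤-trans (≤-reflexive (n≡⌊n+n/2⌋ m)) (⌊n/2⌋-mono m+m≤n)

odd∧2≤⇒3≤ : ∀ {m} → parity m ≡ 1ℙ → 2 ≤ m → 3 ≤ m
odd∧2≤⇒3≤ {suc zero}          _ (s≤s ())
odd∧2≤⇒3≤ {suc (suc (suc m))} _ _ = s≤s (s≤s (s≤s z≤n))

even∧0<⇒2≤ : ∀ {m} → parity m ≡ 0ℙ → 0 < m → 2 ≤ m
even∧0<⇒2≤ {suc (suc m)} _ _ = s≤s (s≤s z≤n)

≢1ℙ⇒≡0ℙ : ∀ {p} → p ≢ 1ℙ → p ≡ 0ℙ
≢1ℙ⇒≡0ℙ {0ℙ} _     = refl
≢1ℙ⇒≡0ℙ {1ℙ} p≢1ℙ = contradiction refl p≢1ℙ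

⊕-cancelˡ : ∀ {x} y z → x ≡ y ⊕ z → z ≡ x ⊕ y
⊕-cancelˡ 0ℙ 0ℙ refl = refl
⊕-cancelˡ 0ℙ 1ℙ refl = refl
⊕-cancelˡ 1ℙ 0ℙ refl = refl
⊕-cancelˡ 1ℙ 1ℙ refl = refl

∣_∣₂ : Subset n → Parity
∣ p ∣₂ = parity ∣ p ∣

-- Requiring domination raises the budget by half a vertex: ⌊ weight true ⊤ /2⌋ = ⌈ n /2⌉.
weight : Bool → Subset n → ℕ
weight false p = ∣ p ∣
weight true  p = suc ∣ p ∣

weight-split : ∀ d (p q : Subset n) → weight d p ≡ ∣ p ∩ q ∣ + weight d (p ∩ ∁ q)
weight-split false p q = ∣p∣≡∣p∩q∣+∣p∩∁q∣ p q
weight-split true  p q = trans (cong suc (∣p∣≡∣p∩q∣+∣p∩∁q∣ p q)) (sym (+-suc _ _))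

weight-remove : ∀ d → x ∈ p → weight d p ≡ suc (weight d (p - x))
weight-remove false x∈p = x∈p⇒∣p∣≡1+∣p-x∣ x∈p
weight-remove true  x∈p = cong suc (x∈p⇒∣p∣≡1+∣p-x∣ x∈p)

parity-split : ∀ d (p q : Subset n) →
               parity (weight d (p ∩ ∁ q)) ≡ parity (weight d p) ⊕ ∣ p ∩ q ∣₂
parity-split d p q =
  ⊕-cancelˡ _ _ (trans (cong parity (weight-split d p q)) (+-homo-+ ∣ p ∩ q ∣ (weight d (p ∩ ∁ q))))

parity-remove : ∀ d → x ∈ p → parity (weight d (p - x)) ≡ parity (weight d p) ⁻¹
parity-remove {x = x} {p} d x∈p =
  trans (sym (suc-homo-⁻¹ (weight d (p - x))))
        (cong (λ m → parity m ⁻¹) (sym (weight-remove d x∈p)))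

parity-∁-split : ∀ (p q r : Subset n) → ∣ (p ∩ ∁ q) ∩ r ∣₂ ≡ ∣ p ∩ r ∣₂ ⊕ ∣ (p ∩ q) ∩ r ∣₂
parity-∁-split p q r = begin
  ∣ (p ∩ ∁ q) ∩ r ∣₂              ≡⟨ cong ∣_∣₂ (∩-swapʳ p (∁ q) r) ⟩
  ∣ (p ∩ r) ∩ ∁ q ∣₂              ≡⟨ parity-split false (p ∩ r) q ⟩
  ∣ p ∩ r ∣₂ ⊕ ∣ (p ∩ r) ∩ q ∣₂    ≡⟨ cong (λ s → ∣ p ∩ r ∣₂ ⊕ ∣ s ∣₂) (∩-swapʳ p r q) ⟩
  ∣ p ∩ r ∣₂ ⊕ ∣ (p ∩ q) ∩ r ∣₂    ∎
  where open ≡-Reasoning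

-- Locating sets relative to a set of vertices

module _ {n : ℕ} (T : Tournament n) where

  infix 4 _⟶_
  _⟶_ : Fin n → Fin n → Set
  u ⟶ v = u ⟶ v within T

  private
    variable
      d : Bool
      u v w : Fin n
      K S′ X Y : Subset n

  out : Fin n → Subset n
  out u = tabulate (arc T u)

  ∈out⁺ : u ⟶ v → v ∈ out u
  ∈out⁺ {u} {v} u⟶v = lookup⇒[]= v (out u) (trans (lookup∘tabulate (arc T u) v) u⟶v)

  ∈out⁻ : v ∈ out u → u ⟶ v
  ∈out⁻ {v} {u} v∈out = trans (sym (lookup∘tabulate (arc T u) v)) ([]=⇒lookup v∈out)

  ⟶-irrefl : ¬ u ⟶ u
  ⟶-irrefl {u} u⟶u with () ← trans (sym u⟶u) (loopless T u)

  ⟶-asym : u ⟶ v → ¬ v ⟶ u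
  ⟶-asym {u} {v} u⟶v v⟶u with u ≟ v
  ... | yes refl = ⟶-irrefl u⟶v
  ... | no  u≢v with () ← trans (sym u⟶v) (trans (unique-arc T u v u≢v) (cong not v⟶u))

  ⟶-total : u ≢ v → u ⟶ v ⊎ v ⟶ u
  ⟶-total {u} {v} u≢v with arc T v u in v⟶u
  ... | true  = inj₂ refl
  ... | false = inj₁ (trans (unique-arc T u v u≢v) (cong not v⟶u))

  ∈∩∁out⁺ : u ∈ X → ¬ w ⟶ u → u ∈ X ∩ ∁ (out w)
  ∈∩∁out⁺ u∈X ¬w⟶u = x∈p∩q⁺ (u∈X , x∉p⇒x∈∁p (¬w⟶u ∘ ∈out⁻))

  arc-within : 2 ≤ ∣ Y ∣ → ∃ λ u → ∃ λ v → u ∈ Y × v ∈ Y × u ⟶ v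
  arc-within 2≤∣Y∣ with 2≤∣p∣⇒∈∧≢ 2≤∣Y∣
  ... | x , y , x∈Y , y∈Y , x≢y with ⟶-total x≢y
  ... | inj₁ x⟶y = x , y , x∈Y , y∈Y , x⟶y
  ... | inj₂ y⟶x = y , x , y∈Y , x∈Y , y⟶x

  Locates : Subset n → Subset n → Set
  Locates S X = ∀ {u v} → u ∈ X → v ∈ X → u ∉ S → v ∉ S → u ≢ v →
                ¬ (∀ w → w ∈ S → (w ⟶ u) ⇔ (w ⟶ v))

  Dominates : Subset n → Subset n → Set
  Dominates S X = ∀ {v} → v ∈ X → v ∉ S → ∃ λ w → w ∈ S × w ⟶ v

  Solves : Bool → Subset n → Subset n → Set
  Solves d S X = Locates S X × (d ≡ true → Dominates S X)

  solves-mono : S ⊆ S′ → Solves d S X → Solves d S′ X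
  solves-mono S⊆S′ (locates , dominates) =
    (λ u∈X v∈X u∉S′ v∉S′ u≢v same →
       locates u∈X v∈X (u∉S′ ∘ S⊆S′) (v∉S′ ∘ S⊆S′) u≢v (λ w w∈S → same w (S⊆S′ w∈S))) ,
    (λ d≡true v∈X v∉S′ → let w , w∈S , w⟶v = dominates d≡true v∈X (v∉S′ ∘ S⊆S′)
                         in w , S⊆S′ w∈S , w⟶v)

  solves-remove : w ∈ S → Solves d S (X - w) → Solves d S X
  solves-remove w∈S (locates , dominates) =
    (λ u∈X v∈X u∉S v∉S → locates (x∈p∧x∉S∧y∈S⇒x∈p-y u∈X u∉S w∈S)
                                 (x∈p∧x∉S∧y∈S⇒x∈p-y v∈X v∉S w∈S) u∉S v∉S) ,
    (λ d≡true v∈X v∉S → dominates d≡true (x∈p∧x∉S∧y∈S⇒x∈p-y v∈X v∉S w∈S) v∉S)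

  solves-split : w ∈ S → Solves false S (X ∩ out w) → Solves d S (X ∩ ∁ (out w)) → Solves d S X
  solves-split {w} {S} {X} {d} w∈S (locates⁺ , _) (locates⁻ , dominates⁻) = locates , dominates
    where
    locates : Locates S X
    locates {u} {v} u∈X v∈X u∉S v∉S u≢v same with u ∈? out w | v ∈? out w
    ... | yes u∈ | yes v∈ = locates⁺ (x∈p∩q⁺ (u∈X , u∈)) (x∈p∩q⁺ (v∈X , v∈)) u∉S v∉S u≢v same
    ... | no  u∉ | no  v∉ =
      locates⁻ (∈∩∁out⁺ u∈X (u∉ ∘ ∈out⁺)) (∈∩∁out⁺ v∈X (v∉ ∘ ∈out⁺)) u∉S v∉S u≢v same
    ... | yes u∈ | no  v∉ = v∉ (∈out⁺ (Equivalence.to   (same w w∈S) (∈out⁻ u∈)))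
    ... | no  u∉ | yes v∈ = u∉ (∈out⁺ (Equivalence.from (same w w∈S) (∈out⁻ v∈)))
    dominates : d ≡ true → Dominates S X
    dominates d≡true {v} v∈X v∉S with v ∈? out w
    ... | yes v∈ = w , w∈S , ∈out⁻ v∈
    ... | no  v∉ = dominates⁻ d≡true (∈∩∁out⁺ v∈X (v∉ ∘ ∈out⁺)) v∉S

  record Solution (d : Bool) (X : Subset n) : Set where
    constructor solution
    field
      set    : Subset n
      solves : Solves d set X
      small  : ∣ set ∣ ≤ ⌊ weight d X /2⌋

  -- A cover solves X together with the keys K, saving s half-vertices against the budget;
  -- every key removed from a part and every part of odd weight saves one.
  record Cover (K : Subset n) (d : Bool) (X : Subset n) (s : ℕ) : Set where
    constructor cover
    field
      set    : Subset n
      solves : Solves d (K ∪ set) X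
      small  : s + (∣ set ∣ + ∣ set ∣) ≤ weight d X

  ∪-monoʳ-⊆ : ∀ (K : Subset n) → S ⊆ S′ → K ∪ S ⊆ K ∪ S′
  ∪-monoʳ-⊆ {S} K S⊆S′ x∈K∪S with x∈p∪q⁻ K S x∈K∪S
  ... | inj₁ x∈K = x∈p∪q⁺ (inj₁ x∈K)
  ... | inj₂ x∈S = x∈p∪q⁺ (inj₂ (S⊆S′ x∈S))

  cover-leaf : Solution d Y → Cover K d Y 0
  cover-leaf {d} {Y} {K} (solution S solves small) =
    cover S (solves-mono (q⊆p∪q K S) solves)
      (≤-trans (+-mono-≤ small small) (⌊n/2⌋+⌊n/2⌋≤n (weight d Y)))

  cover-oddLeaf : parity (weight d Y) ≡ 1ℙ → Solution d Y → Cover K d Y 1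
  cover-oddLeaf {d} {Y} {K} odd (solution S solves small) =
    cover S (solves-mono (q⊆p∪q K S) solves)
      (≤-trans (s≤s (+-mono-≤ small small)) (⌊n/2⌋+⌊n/2⌋<n (weight d Y) odd))

  cover-remove : ∀ {s} → w ∈ K → w ∈ X → Cover K d (X - w) s → Cover K d X (suc s)
  cover-remove {d = d} w∈K w∈X (cover S solves small) =
    cover S (solves-remove (p⊆p∪q S w∈K) solves)
      (≤-trans (s≤s small) (≤-reflexive (sym (weight-remove d w∈X))))

  cover-split : ∀ {s t} → w ∈ K →
                Cover K false (X ∩ out w) s → Cover K d (X ∩ ∁ (out w)) t → Cover K d X (s + t)
  cover-split {w} {K} {X} {d} {s} {t} w∈K (cover S₁ solves₁ small₁) (cover S₂ solves₂ small₂) =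
    cover (S₁ ∪ S₂)
      (solves-split (p⊆p∪q (S₁ ∪ S₂) w∈K)
        (solves-mono (∪-monoʳ-⊆ K (p⊆p∪q S₂)) solves₁)
        (solves-mono (∪-monoʳ-⊆ K (q⊆p∪q S₁ S₂)) solves₂))
      (begin
        s + t + (∣ S₁ ∪ S₂ ∣ + ∣ S₁ ∪ S₂ ∣)       ≤⟨ +-monoʳ-≤ (s + t) (+-mono-≤ ∣S₁∪S₂∣ ∣S₁∪S₂∣) ⟩
        s + t + ((a + b) + (a + b))               ≡⟨ cong (s + t +_) (interchange a b a b) ⟩
        s + t + ((a + a) + (b + b))               ≡⟨ interchange s t (a + a) (b + b) ⟩
        (s + (a + a)) + (t + (b + b))             ≤⟨ +-mono-≤ small₁ small₂ ⟩
        ∣ X ∩ out w ∣ + weight d (X ∩ ∁ (out w))  ≡⟨ sym (weight-split d X (out w)) ⟩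
        weight d X                                ∎)
    where
    open ≤-Reasoning
    a b : ℕ
    a = ∣ S₁ ∣
    b = ∣ S₂ ∣
    ∣S₁∪S₂∣ : ∣ S₁ ∪ S₂ ∣ ≤ a + b
    ∣S₁∪S₂∣ = ∣p∪q∣≤∣p∣+∣q∣ S₁ S₂

  solution-fromCover : ∀ {s} → Cover K d X s → ∣ K ∣ + ∣ K ∣ ≤ s → Solution d X
  solution-fromCover {K} {d} {X} {s} (cover S solves small) 2∣K∣≤s =
    solution (K ∪ S) solves (m+m≤n⇒m≤⌊n/2⌋ (begin
      ∣ K ∪ S ∣ + ∣ K ∪ S ∣    ≤⟨ +-mono-≤ ∣K∪S∣ ∣K∪S∣ ⟩
      (k + a) + (k + a)        ≡⟨ interchange k a k a ⟩
      (k + k) + (a + a)        ≤⟨ +-monoˡ-≤ (a + a) 2∣K∣≤s ⟩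
      s + (a + a)              ≤⟨ small ⟩
      weight d X               ∎))
    where
    open ≤-Reasoning
    k a : ℕ
    k = ∣ K ∣
    a = ∣ S ∣
    ∣K∪S∣ : ∣ K ∪ S ∣ ≤ k + a
    ∣K∪S∣ = ∣p∪q∣≤∣p∣+∣q∣ K S

  locates-≤1 : ∣ X ∣ ≤ 1 → Locates S X
  locates-≤1 ∣X∣≤1 u∈X v∈X _ _ u≢v _ =
    contradiction (≤-trans (∈∧≢⇒2≤∣p∣ u∈X v∈X u≢v) ∣X∣≤1) λ { (s≤s ()) }

  dominates-∅ : ∣ X ∣ ≡ 0 → Dominates S X
  dominates-∅ ∣X∣≡0 v∈X _ with () ← subst (0 <_) ∣X∣≡0 (x∈p⇒0<∣p∣ v∈X)

  solution-small : ∀ d X → weight d X ≤ 1 → Solution d X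
  solution-small false X ∣X∣≤1 =
    solution ⊥ (locates-≤1 ∣X∣≤1 , λ ()) (≤-trans (≤-reflexive (∣⊥∣≡0 n)) z≤n)
  solution-small true X (s≤s ∣X∣≤0) =
    solution ⊥ (locates-≤1 (≤-trans ∣X∣≤0 z≤n) , λ _ → dominates-∅ (n≤0⇒n≡0 ∣X∣≤0))
      (≤-trans (≤-reflexive (∣⊥∣≡0 n)) z≤n)

  SolvedBelow : Subset n → Set
  SolvedBelow X = ∀ {Y} → ∣ Y ∣ < ∣ X ∣ → ∀ d → Solution d Y

  ∣X∩out∣<∣X∣ : w ∈ X → ∣ X ∩ out w ∣ < ∣ X ∣
  ∣X∩out∣<∣X∣ {w} {X} w∈X =
    p⊂q⇒∣p∣<∣q∣ (p∩q⊆p X (out w) , w , w∈X , ⟶-irrefl ∘ ∈out⁻ ∘ proj₂ ∘ x∈p∩q⁻ X (out w))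

  ∣X∩∁out∣<∣X∣ : u ∈ X → w ⟶ u → ∣ X ∩ ∁ (out w) ∣ < ∣ X ∣
  ∣X∩∁out∣<∣X∣ {u} {X} {w} u∈X w⟶u =
    p⊂q⇒∣p∣<∣q∣ (p∩q⊆p X _ , u , u∈X ,
                 λ u∈ → x∈∁p⇒x∉p (proj₂ (x∈p∩q⁻ X (∁ (out w)) u∈)) (∈out⁺ w⟶u))

  one-key : SolvedBelow X → w ∈ X →
            ∣ X ∩ out w ∣₂ ≡ 1ℙ ⊎ parity (weight d (X ∩ ∁ (out w) - w)) ≡ 1ℙ → Solution d X
  one-key {X} {w} {d} solved w∈X odd =
    solution-fromCover (split odd) (≤-reflexive (cong₂ _+_ (∣⁅x⁆∣≡1 w) (∣⁅x⁆∣≡1 w)))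
    where
    w∈K : w ∈ ⁅ w ⁆
    w∈K = x∈⁅x⁆ w
    w∈X̄ : w ∈ X ∩ ∁ (out w)
    w∈X̄ = ∈∩∁out⁺ w∈X ⟶-irrefl
    above : ∀ d′ → Solution d′ (X ∩ out w)
    above = solved (∣X∩out∣<∣X∣ w∈X)
    below : Solution d (X ∩ ∁ (out w) - w)
    below = solved (<-≤-trans (x∈p⇒∣p-x∣<∣p∣ w∈X̄) (∣p∩q∣≤∣p∣ X _)) d
    split : ∣ X ∩ out w ∣₂ ≡ 1ℙ ⊎ parity (weight d (X ∩ ∁ (out w) - w)) ≡ 1ℙ → Cover ⁅ w ⁆ d X 2
    split (inj₁ odd) =
      cover-split w∈K (cover-oddLeaf odd (above false)) (cover-remove w∈K w∈X̄ (cover-leaf below))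
    split (inj₂ odd) =
      cover-split w∈K (cover-leaf (above false)) (cover-remove w∈K w∈X̄ (cover-oddLeaf odd below))

  EvenOutDegrees : Subset n → Set
  EvenOutDegrees X = ∀ {u} → u ∈ X → ∣ X ∩ out u ∣₂ ≡ 0ℙ

  EvenPairs : Subset n → Set
  EvenPairs X = ∀ {u v} → u ∈ X → v ∈ X → u ⟶ v → ∣ (X ∩ out u) ∩ out v ∣₂ ≡ 0ℙ

  two-keys : SolvedBelow X → EvenOutDegrees X → u ∈ X → v ∈ X → u ⟶ v →
             ∣ (X ∩ out u) ∩ out v ∣₂ ≡ 1ℙ → Solution d X
  two-keys {X} {u} {v} {d} solved even u∈X v∈X u⟶v odd =
    solution-fromCover
      (cover-split u∈K
        (cover-split v∈K
          (cover-oddLeaf odd (above (p∩q⊆p _ _) false))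
          (cover-remove v∈K v∈X₁₀ (cover-leaf (above (⊆-trans (p─q⊆p _ _) (p∩q⊆p _ _)) false))))
        (cover-split v∈K
          (cover-oddLeaf odd₀₁ (below (p∩q⊆p _ _) false))
          (cover-remove u∈K u∈X₀₀ (cover-leaf (below (⊆-trans (p─q⊆p _ _) (p∩q⊆p _ _)) d)))))
      (+-mono-≤ ∣K∣≤2 ∣K∣≤2)
    where
    keys : Subset n
    keys = ⁅ u ⁆ ∪ ⁅ v ⁆
    u∈K : u ∈ keys
    u∈K = x∈p∪q⁺ (inj₁ (x∈⁅x⁆ u))
    v∈K : v ∈ keys
    v∈K = x∈p∪q⁺ (inj₂ (x∈⁅x⁆ v))
    ∣K∣≤2 : ∣ keys ∣ ≤ 2
    ∣K∣≤2 = ≤-trans (∣p∪q∣≤∣p∣+∣q∣ ⁅ u ⁆ ⁅ v ⁆) (≤-reflexive (cong₂ _+_ (∣⁅x⁆∣≡1 u) (∣⁅x⁆∣≡1 v)))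
    v∈X₁₀ : v ∈ (X ∩ out u) ∩ ∁ (out v)
    v∈X₁₀ = ∈∩∁out⁺ (x∈p∩q⁺ (v∈X , ∈out⁺ u⟶v)) ⟶-irrefl
    u∈X₀₀ : u ∈ (X ∩ ∁ (out u)) ∩ ∁ (out v)
    u∈X₀₀ = ∈∩∁out⁺ (∈∩∁out⁺ u∈X ⟶-irrefl) (⟶-asym u⟶v)
    above : Y ⊆ X ∩ out u → ∀ d′ → Solution d′ Y
    above Y⊆ = solved (≤-<-trans (p⊆q⇒∣p∣≤∣q∣ Y⊆) (∣X∩out∣<∣X∣ u∈X))
    below : Y ⊆ X ∩ ∁ (out u) → ∀ d′ → Solution d′ Y
    below Y⊆ = solved (≤-<-trans (p⊆q⇒∣p∣≤∣q∣ Y⊆) (∣X∩∁out∣<∣X∣ v∈X u⟶v))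
    odd₀₁ : ∣ (X ∩ ∁ (out u)) ∩ out v ∣₂ ≡ 1ℙ
    odd₀₁ = trans (parity-∁-split X (out u) (out v)) (cong₂ _⊕_ (even v∈X) odd)

  record Triangle (X : Subset n) : Set where
    constructor triangle
    field
      {a b c} : Fin n
      a∈X     : a ∈ X
      b∈X     : b ∈ X
      c∈X     : c ∈ X
      a⟶b     : a ⟶ b
      b⟶c     : b ⟶ c
      c⟶a     : c ⟶ a

  -- The parity of the common out-degree of the triangle decides which parts are odd:
  -- the three parts inside out a when it is odd, the three parts that lost a key otherwise.
  module _ (solved : SolvedBelow X) (even : EvenOutDegrees X) (pairs : EvenPairs X)
           (t : Triangle X) where
    open Triangle t

    private
      keys : Subset n
      keys = ⁅ a ⁆ ∪ ⁅ b ⁆ ∪ ⁅ c ⁆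
      a∈K : a ∈ keys
      a∈K = x∈p∪q⁺ (inj₁ (x∈⁅x⁆ a))
      b∈K : b ∈ keys
      b∈K = x∈p∪q⁺ (inj₂ (x∈p∪q⁺ (inj₁ (x∈⁅x⁆ b))))
      c∈K : c ∈ keys
      c∈K = x∈p∪q⁺ (inj₂ (x∈p∪q⁺ (inj₂ (x∈⁅x⁆ c))))
      ∣K∣≤3 : ∣ keys ∣ ≤ 3
      ∣K∣≤3 = ≤-trans (∣p∪q∣≤∣p∣+∣q∣ ⁅ a ⁆ _)
                (≤-trans (+-mono-≤ (≤-reflexive (∣⁅x⁆∣≡1 a)) (∣p∪q∣≤∣p∣+∣q∣ ⁅ b ⁆ ⁅ c ⁆))
                  (≤-reflexive (cong₂ (λ i j → 1 + (i + j)) (∣⁅x⁆∣≡1 b) (∣⁅x⁆∣≡1 c))))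
      above : Y ⊆ X ∩ out a → ∀ d′ → Solution d′ Y
      above Y⊆ = solved (≤-<-trans (p⊆q⇒∣p∣≤∣q∣ Y⊆) (∣X∩out∣<∣X∣ a∈X))
      below : Y ⊆ X ∩ ∁ (out a) → ∀ d′ → Solution d′ Y
      below Y⊆ = solved (≤-<-trans (p⊆q⇒∣p∣≤∣q∣ Y⊆) (∣X∩∁out∣<∣X∣ b∈X a⟶b))
      pair-ab : ∣ (X ∩ out a) ∩ out b ∣₂ ≡ 0ℙ
      pair-ab = pairs a∈X b∈X a⟶b

    three-keys-odd : ∣ ((X ∩ out a) ∩ out b) ∩ out c ∣₂ ≡ 1ℙ → Solution d X
    three-keys-odd {d} odd =
      solution-fromCover
        (cover-split a∈K
          (cover-split b∈K
            (cover-split c∈K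
              (cover-oddLeaf odd (above (⊆-trans (p∩q⊆p _ _) (p∩q⊆p _ _)) false))
              (cover-oddLeaf odd₁₁₀ (above (⊆-trans (p∩q⊆p _ _) (p∩q⊆p _ _)) false)))
            (cover-remove b∈K b∈X₁₀
              (cover-oddLeaf odd₁₀ (above (⊆-trans (p─q⊆p _ _) (p∩q⊆p _ _)) false))))
          (cover-remove a∈K a∈X₀ (cover-remove c∈K c∈X₀-a
            (cover-leaf (below (⊆-trans (p─q⊆p _ _) (p─q⊆p _ _)) d)))))
        (+-mono-≤ ∣K∣≤3 ∣K∣≤3)
      where
      b∈X₁₀ : b ∈ (X ∩ out a) ∩ ∁ (out b)
      b∈X₁₀ = ∈∩∁out⁺ (x∈p∩q⁺ (b∈X , ∈out⁺ a⟶b)) ⟶-irrefl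
      a∈X₀ : a ∈ X ∩ ∁ (out a)
      a∈X₀ = ∈∩∁out⁺ a∈X ⟶-irrefl
      c∈X₀-a : c ∈ X ∩ ∁ (out a) - a
      c∈X₀-a = x∈p∧x≢y⇒x∈p-y (∈∩∁out⁺ c∈X (⟶-asym c⟶a)) λ { refl → ⟶-irrefl c⟶a }
      odd₁₁₀ : ∣ ((X ∩ out a) ∩ out b) ∩ ∁ (out c) ∣₂ ≡ 1ℙ
      odd₁₁₀ = trans (parity-split false ((X ∩ out a) ∩ out b) (out c)) (cong₂ _⊕_ pair-ab odd)
      odd₁₀ : ∣ (X ∩ out a) ∩ ∁ (out b) - b ∣₂ ≡ 1ℙ
      odd₁₀ = trans (parity-remove false b∈X₁₀)
                (cong _⁻¹ (trans (parity-split false (X ∩ out a) (out b))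
                                 (cong₂ _⊕_ (even a∈X) pair-ab)))

    three-keys-even : ∣ ((X ∩ out a) ∩ out b) ∩ out c ∣₂ ≡ 0ℙ → Solution d X
    three-keys-even {d} even₁₁₁ =
      solution-fromCover
        (cover-split a∈K
          (cover-remove b∈K b∈X₁ (cover-oddLeaf odd₁ (above (p─q⊆p _ _) false)))
          (cover-split b∈K
            (cover-remove c∈K c∈X₀₁
              (cover-oddLeaf odd₀₁ (below (⊆-trans (p─q⊆p _ _) (p∩q⊆p _ _)) false)))
            (cover-split c∈K
              (cover-remove a∈K a∈X₀₀₁
                (cover-oddLeaf odd₀₀₁
                  (below (⊆-trans (p─q⊆p _ _) (⊆-trans (p∩q⊆p _ _) (p∩q⊆p _ _))) false)))
              (cover-leaf (below (⊆-trans (p∩q⊆p _ _) (p∩q⊆p _ _)) d)))))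
        (+-mono-≤ ∣K∣≤3 ∣K∣≤3)
      where
      b∈X₁ : b ∈ X ∩ out a
      b∈X₁ = x∈p∩q⁺ (b∈X , ∈out⁺ a⟶b)
      c∈X₀₁ : c ∈ (X ∩ ∁ (out a)) ∩ out b
      c∈X₀₁ = x∈p∩q⁺ (∈∩∁out⁺ c∈X (⟶-asym c⟶a) , ∈out⁺ b⟶c)
      a∈X₀₀₁ : a ∈ ((X ∩ ∁ (out a)) ∩ ∁ (out b)) ∩ out c
      a∈X₀₀₁ = x∈p∩q⁺ (∈∩∁out⁺ (∈∩∁out⁺ a∈X ⟶-irrefl) (⟶-asym a⟶b) , ∈out⁺ c⟶a)
      even₀₀₁ : ∣ ((X ∩ ∁ (out a)) ∩ ∁ (out b)) ∩ out c ∣₂ ≡ 0ℙ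
      even₀₀₁ = begin
        ∣ ((X ∩ ∁ (out a)) ∩ ∁ (out b)) ∩ out c ∣₂
          ≡⟨ parity-∁-split (X ∩ ∁ (out a)) (out b) (out c) ⟩
        ∣ (X ∩ ∁ (out a)) ∩ out c ∣₂ ⊕ ∣ ((X ∩ ∁ (out a)) ∩ out b) ∩ out c ∣₂
          ≡⟨ cong₂ _⊕_ (parity-∁-split X (out a) (out c))
                       (cong (λ Z → ∣ Z ∩ out c ∣₂) (∩-swapʳ X (∁ (out a)) (out b))) ⟩
        (∣ X ∩ out c ∣₂ ⊕ ∣ (X ∩ out a) ∩ out c ∣₂) ⊕ ∣ ((X ∩ out b) ∩ ∁ (out a)) ∩ out c ∣₂
          ≡⟨ cong₂ _⊕_ (cong₂ _⊕_ (even c∈X) (trans (cong ∣_∣₂ (∩-swapʳ X (out a) (out c)))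
                                                    (pairs c∈X a∈X c⟶a)))
                       (parity-∁-split (X ∩ out b) (out a) (out c)) ⟩
        (0ℙ ⊕ 0ℙ) ⊕ (∣ (X ∩ out b) ∩ out c ∣₂ ⊕ ∣ ((X ∩ out b) ∩ out a) ∩ out c ∣₂)
          ≡⟨ cong ((0ℙ ⊕ 0ℙ) ⊕_)
               (cong₂ _⊕_ (pairs b∈X c∈X b⟶c)
                          (trans (cong (λ Z → ∣ Z ∩ out c ∣₂) (∩-swapʳ X (out b) (out a)))
                                 even₁₁₁)) ⟩
        (0ℙ ⊕ 0ℙ) ⊕ (0ℙ ⊕ 0ℙ)
          ∎
        where open ≡-Reasoning
      odd₁ : ∣ X ∩ out a - b ∣₂ ≡ 1ℙ
      odd₁ = trans (parity-remove false b∈X₁) (cong _⁻¹ (even a∈X))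
      odd₀₁ : ∣ (X ∩ ∁ (out a)) ∩ out b - c ∣₂ ≡ 1ℙ
      odd₀₁ = trans (parity-remove false c∈X₀₁)
                (cong _⁻¹ (trans (parity-∁-split X (out a) (out b)) (cong₂ _⊕_ (even b∈X) pair-ab)))
      odd₀₀₁ : ∣ ((X ∩ ∁ (out a)) ∩ ∁ (out b)) ∩ out c - a ∣₂ ≡ 1ℙ
      odd₀₀₁ = trans (parity-remove false a∈X₀₀₁) (cong _⁻¹ even₀₀₁)

    three-keys : Solution d X
    three-keys with ∣ ((X ∩ out a) ∩ out b) ∩ out c ∣₂ in τ
    ... | 1ℙ = three-keys-odd τ
    ... | 0ℙ = three-keys-even τ

  triangle-or-descent : v ∈ X → u ∈ X → v ⟶ u → Triangle X ⊎ X ∩ out u ⊆ X ∩ out v - u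
  triangle-or-descent {v} {X} {u} v∈X u∈X v⟶u with nonempty? ((X ∩ out u) ∩ ∁ (out v) - v)
  ... | no ∄z = inj₂ out-u⊆
    where
    out-u⊆ : X ∩ out u ⊆ X ∩ out v - u
    out-u⊆ {z} z∈ with x∈p∩q⁻ X (out u) z∈ | z ∈? out v
    ... | z∈X , z∈out-u | yes z∈out-v =
      x∈p∧x≢y⇒x∈p-y (x∈p∩q⁺ (z∈X , z∈out-v)) λ { refl → ⟶-irrefl (∈out⁻ z∈out-u) }
    ... | z∈X , z∈out-u | no z∉out-v =
      contradiction (z , x∈p∧x≢y⇒x∈p-y (x∈p∩q⁺ (z∈ , x∉p⇒x∈∁p z∉out-v)) z≢v) ∄z
      where
      z≢v : z ≢ v
      z≢v refl = ⟶-asym v⟶u (∈out⁻ z∈out-u)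
  ... | yes (z , z∈) with x∈p∩q⁻ (X ∩ out u) (∁ (out v)) (p─q⊆p _ _ z∈)
  ...   | z∈X∩out-u , z∉out-v with x∈p∩q⁻ X (out u) z∈X∩out-u
  ...     | z∈X , z∈out-u = inj₁ (triangle v∈X u∈X z∈X v⟶u (∈out⁻ z∈out-u) z⟶v)
    where
    z⟶v : z ⟶ v
    z⟶v with ⟶-total (x∈p-y⇒x≢y z∈)
    ... | inj₁ z⟶v = z⟶v
    ... | inj₂ v⟶z = contradiction (∈out⁺ v⟶z) (x∈∁p⇒x∉p z∉out-v)

  -- Descent on the out-degree: an even nonempty out-neighbourhood contains an arc y₀ → y₁,
  -- so y₀ again has a nonempty out-neighbourhood, strictly smaller unless a triangle appears.
  triangle-from : EvenOutDegrees X → v ∈ X → Nonempty (X ∩ out v) → Triangle X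
  triangle-from {X} {v} even = All.wfRec (On.wellFounded outDegree <-wellFounded) 0ℓ P step v
    where
    outDegree : Fin n → ℕ
    outDegree u = ∣ X ∩ out u ∣
    P : Fin n → Set
    P v = v ∈ X → Nonempty (X ∩ out v) → Triangle X
    step : ∀ v → WfRec (_<_ on outDegree) P v → P v
    step v rec v∈X (y , y∈) with arc-within (even∧0<⇒2≤ (even v∈X) (x∈p⇒0<∣p∣ y∈))
    ... | y₀ , y₁ , y₀∈ , y₁∈ , y₀⟶y₁ with x∈p∩q⁻ X (out v) y₀∈ | x∈p∩q⁻ X (out v) y₁∈
    ... | y₀∈X , y₀∈out-v | y₁∈X , _ with triangle-or-descent v∈X y₀∈X (∈out⁻ y₀∈out-v)
    ... | inj₁ t          = t
    ... | inj₂ out-y₀⊆ =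
      rec (≤-<-trans (p⊆q⇒∣p∣≤∣q∣ out-y₀⊆) (x∈p⇒∣p-x∣<∣p∣ y₀∈)) y₀∈X
          (y₁ , x∈p∩q⁺ (y₁∈X , ∈out⁺ y₀⟶y₁))

  triangle-exists : EvenOutDegrees X → 2 ≤ ∣ X ∣ → Triangle X
  triangle-exists even 2≤∣X∣ with arc-within 2≤∣X∣
  ... | u , v , u∈X , v∈X , u⟶v = triangle-from even u∈X (v , x∈p∩q⁺ (v∈X , ∈out⁺ u⟶v))

  oddOutDegree⊎EvenOutDegrees : ∀ X → (∃ λ u → u ∈ X × ∣ X ∩ out u ∣₂ ≡ 1ℙ) ⊎ EvenOutDegrees X
  oddOutDegree⊎EvenOutDegrees X with any? (λ u → (u ∈? X) ×-dec (∣ X ∩ out u ∣₂ ℙ.≟ 1ℙ))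
  ... | yes odd = inj₁ odd
  ... | no  ∄odd = inj₂ λ {u} u∈X → ≢1ℙ⇒≡0ℙ (λ odd → ∄odd (u , u∈X , odd))

  oddPair⊎EvenPairs : ∀ X →
    (∃ λ u → ∃ λ v → u ∈ X × v ∈ X × u ⟶ v × ∣ (X ∩ out u) ∩ out v ∣₂ ≡ 1ℙ) ⊎ EvenPairs X
  oddPair⊎EvenPairs X with any? (λ u → any? (λ v →
    (u ∈? X) ×-dec (v ∈? X) ×-dec (arc T u v 𝔹.≟ true) ×-dec (∣ (X ∩ out u) ∩ out v ∣₂ ℙ.≟ 1ℙ)))
  ... | yes odd = inj₁ odd
  ... | no  ∄odd =
    inj₂ λ {u} {v} u∈X v∈X u⟶v → ≢1ℙ⇒≡0ℙ (λ odd → ∄odd (u , v , u∈X , v∈X , u⟶v , odd))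

  evenWeight⇒oddPart : ∀ d → parity (weight d X) ≡ 0ℙ → w ∈ X →
    ∣ X ∩ out w ∣₂ ≡ 1ℙ ⊎ parity (weight d (X ∩ ∁ (out w) - w)) ≡ 1ℙ
  evenWeight⇒oddPart {X} {w} d even w∈X with ∣ X ∩ out w ∣₂ in odd?
  ... | 1ℙ = inj₁ refl
  ... | 0ℙ = inj₂ (trans (parity-remove d (∈∩∁out⁺ w∈X ⟶-irrefl))
                    (cong _⁻¹ (trans (parity-split d X (out w)) (cong₂ _⊕_ even odd?))))

  oddWeight⇒2≤∣X∣ : ∀ d (X : Subset n) → 2 ≤ weight d X → parity (weight d X) ≡ 1ℙ → 2 ≤ ∣ X ∣
  oddWeight⇒2≤∣X∣ false X 2≤w _   = 2≤w
  oddWeight⇒2≤∣X∣ true  X 2≤w odd = s≤s⁻¹ (odd∧2≤⇒3≤ odd 2≤w)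

  2≤weight⇒0<∣X∣ : ∀ d (X : Subset n) → 2 ≤ weight d X → 0 < ∣ X ∣
  2≤weight⇒0<∣X∣ false X 2≤w       = <-≤-trans (s≤s z≤n) 2≤w
  2≤weight⇒0<∣X∣ true  X (s≤s 1≤w) = 1≤w

  solve-oddWeight : SolvedBelow X → 2 ≤ weight d X → parity (weight d X) ≡ 1ℙ → Solution d X
  solve-oddWeight {X} {d} solved 2≤w odd with oddOutDegree⊎EvenOutDegrees X
  ... | inj₁ (u , u∈X , odd-u) = one-key solved u∈X (inj₁ odd-u)
  ... | inj₂ even with oddPair⊎EvenPairs X
  ...   | inj₁ (u , v , u∈X , v∈X , u⟶v , odd-uv) = two-keys solved even u∈X v∈X u⟶v odd-uv
  ...   | inj₂ pairs =
    three-keys solved even pairs (triangle-exists even (oddWeight⇒2≤∣X∣ d X 2≤w odd))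

  solve : ∀ X → SolvedBelow X → ∀ d → Solution d X
  solve X solved d with weight d X ≤? 1
  ... | yes w≤1 = solution-small d X w≤1
  ... | no  w≰1 with parity (weight d X) in parity-w
  ...   | 1ℙ = solve-oddWeight solved (≰⇒> w≰1) parity-w
  ...   | 0ℙ = let w , w∈X = 0<∣p∣⇒Nonempty (2≤weight⇒0<∣X∣ d X (≰⇒> w≰1))
               in one-key solved w∈X (evenWeight⇒oddPart d parity-w w∈X)

  solution-exists : ∀ d X → Solution d X
  solution-exists d X =
    All.wfRec (On.wellFounded ∣_∣ <-wellFounded) 0ℓ (λ X → ∀ d → Solution d X) solve X d

  solution⇒LocationNumber≤ : Solution false ⊤ → LocationNumber≤ T ⌊ n /2⌋
  solution⇒LocationNumber≤ (solution S (locates , _) small) =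
    S , (λ u v → locates ∈⊤ ∈⊤) , subst (λ m → ∣ S ∣ ≤ ⌊ m /2⌋) (∣⊤∣≡n n) small

  solution⇒γL≤ : Solution true ⊤ → γL≤ T ⌈ n /2⌉
  solution⇒γL≤ (solution S (locates , dominates) small) =
    S , ((λ u v → locates ∈⊤ ∈⊤) , (λ v → dominates refl ∈⊤)) ,
    subst (λ m → ∣ S ∣ ≤ ⌈ m /2⌉) (∣⊤∣≡n n) small

theorem13 : (n : ℕ) (T : Tournament n) →
    γL≤ T ⌈ n /2⌉ × LocationNumber≤ T ⌊ n /2⌋
theorem13 n T =
  solution⇒γL≤ T (solution-exists T true ⊤) , solution⇒LocationNumber≤ T (solution-exists T false ⊤)
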